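{- Let $\mathcal I$ be an implication algebra and let $\langle a,b\rangle,\langle c,d\rangle\in\mathsf I(\mathcal I)$. Then $\langle a,b\rangle\sim\langle c,d\rangle$ if and only if $a\wedge b=c\wedge d$.
   Context: An implication algebra is a join-semilattice with top $\mathbf 1$ in which every interval $[a,\mathbf 1]$ is a Boolean algebra, $x\to y$ being the complement of $x\vee y$ in $[y,\mathbf 1]$; meets need not exist. For an implication algebra $\mathcal I$, $\mathsf I(\mathcal I)=\{\langle a,b\rangle : a,b\in\mathcal I,\ a\vee b=\mathbf 1,\ a\wedge b\text{ exists}\}$, ordered componentwise, with join $\langle a,b\rangle\vee\langle c,d\rangle=\langle a\vee c,b\vee d\rangle$, top $\langle\mathbf 1,\mathbf 1\rangle$, and for $\langle c,d\rangle\le\langle a,b\rangle$, $\Delta(\langle a,b\rangle,\langle c,d\rangle)=\langle a\wedge(b\to d),b\wedge(a\to c)\rangle$. For elements $x,y$, $x\sim y$ means $\Delta(x\vee y,x)=y$. -}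

module Defs where

open import Level using (Level; _⊔_; suc)
open import Data.Product using (Σ; Σ-syntax; _×_; _,_)
open import Relation.Binary.PropositionalEquality using (_≡_)
open import Relation.Binary.Structures using (IsPartialOrder)

-- Meets need not exist globally.
record ImplicationAlgebra (c ℓ : Level) : Set (suc (c ⊔ ℓ)) where
  infix  4 _≤_
  infixr 6 _∨_
  infixr 5 _⇒_
  field
    Carrier        : Set c
    _≤_            : Carrier → Carrier → Set ℓ
    isPartialOrder : IsPartialOrder _≡_ _≤_
    _∨_            : Carrier → Carrier → Carrier
    𝟏              : Carrier
    _⇒_            : Carrier → Carrier → Carrier
    x≤x∨y          : ∀ x y → x ≤ x ∨ y
    y≤x∨y          : ∀ x y → y ≤ x ∨ y
    ∨-least        : ∀ {x y z} → x ≤ z → y ≤ z → x ∨ y ≤ z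
    ≤𝟏             : ∀ x → x ≤ 𝟏

  IsMeetIn : Carrier → Carrier → Carrier → Carrier → Set (c ⊔ ℓ)
  IsMeetIn a x y m =
    a ≤ m × m ≤ x × m ≤ y × (∀ z → a ≤ z → z ≤ x → z ≤ y → z ≤ m)

  IsMeet : Carrier → Carrier → Carrier → Set (c ⊔ ℓ)
  IsMeet x y m = m ≤ x × m ≤ y × (∀ z → z ≤ x → z ≤ y → z ≤ m)

  field
    -- every interval [a,𝟏] is a Boolean algebra (joins ∨, top 𝟏, bottom a):
    -- it has binary meets,
    interval-meet  : ∀ a x y → a ≤ x → a ≤ y → Σ[ m ∈ Carrier ] IsMeetIn a x y m
    interval-distr : ∀ {a x y z m₁ m₂ m₃} → a ≤ x → a ≤ y → a ≤ z →
                     IsMeetIn a x (y ∨ z) m₁ → IsMeetIn a x y m₂ →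
                     IsMeetIn a x z m₃ → m₁ ≡ m₂ ∨ m₃
    interval-compl : ∀ a x → a ≤ x →
                     Σ[ x' ∈ Carrier ] (a ≤ x' × x ∨ x' ≡ 𝟏 × IsMeetIn a x x' a)
    ⇒-compl        : ∀ x y → y ≤ (x ⇒ y) × (x ∨ y) ∨ (x ⇒ y) ≡ 𝟏
                              × IsMeetIn y (x ∨ y) (x ⇒ y) y

module _ {c ℓ} (𝓘 : ImplicationAlgebra c ℓ) where
  open ImplicationAlgebra 𝓘

  record IElem : Set (c ⊔ ℓ) where
    constructor ⟨_,_⟩[_,_,_]
    field
      fst   : Carrier
      snd   : Carrier
      join𝟏 : fst ∨ snd ≡ 𝟏
      meet  : Carrier
      isMeet : IsMeet fst snd meet

  open IElem public

  -- Underlying pair of the join ⟨a,b⟩ ∨ ⟨c,d⟩ = ⟨a ∨ c , b ∨ d⟩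
  -- Δ(⟨a,b⟩,⟨c,d⟩) = ⟨a ∧ (b ⇒ d), b ∧ (a ⇒ c)⟩, stated relationally:
  -- "Δ(⟨a,b⟩,⟨c,d⟩) = ⟨e,f⟩" since meets are only partially defined.
  ΔIs : Carrier → Carrier → Carrier → Carrier → Carrier → Carrier → Set (c ⊔ ℓ)
  ΔIs a b c' d e f = IsMeet a (b ⇒ d) e × IsMeet b (a ⇒ c') f

  -- x ∼ y  iff  Δ(x ∨ y, x) = y
  _∼_ : IElem → IElem → Set (c ⊔ ℓ)
  x ∼ y = ΔIs (fst x ∨ fst y) (snd x ∨ snd y) (fst x) (snd x) (fst y) (snd y)

module Submission where

-- Unfolding the definitions, ⟨a,b⟩ ∼ ⟨c,d⟩ says that
--   (a ∨ c) ∧ ((b ∨ d) ⇒ b) = c   and   (b ∨ d) ∧ ((a ∨ c) ⇒ a) = d.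
-- The proof uses only three facts about an implication algebra:
--   * modus ponens: a lower bound of s and of s ⇒ p lies below p;
--   * distributivity of the Boolean interval [m,𝟏], in the form
--     (r ∨ p) ∧ (r ∨ q) = r  whenever  p ∧ q = m ≤ r;
--   * if c ∨ d = 𝟏 and c ∧ d ≤ b, then (b ∨ d) ⇒ b = c ∨ b.
-- "⇒": the two meets above give a ∧ b ≤ c, d, while modus ponens gives
-- c ∧ d ≤ a, b, so the two meets coincide.
-- "⇐": if a ∧ b = c ∧ d then (b ∨ d) ⇒ b = c ∨ b, and
-- (a ∨ c) ∧ (c ∨ b) = c by distributivity; the second equation is symmetric.

open import Defs
open import Relation.Binary.PropositionalEquality using (_≡_; refl; sym; trans; subst; subst₂)
open import Data.Product using (_×_; _,_; proj₁; proj₂)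
open import Relation.Binary.Structures using (IsPartialOrder)

module ImplicationAlgebraProperties {ℓ₁ ℓ₂} (𝓘 : ImplicationAlgebra ℓ₁ ℓ₂) where
  open ImplicationAlgebra 𝓘
  open IsPartialOrder isPartialOrder
    using () renaming (trans to ≤-trans; antisym to ≤-antisym)

  private variable
    a b c d e m n p q r s t w R : Carrier

  ≤-refl : w ≤ w
  ≤-refl = IsPartialOrder.reflexive isPartialOrder refl

  ∨-comm≤ : ∀ x y → x ∨ y ≤ y ∨ x
  ∨-comm≤ x y = ∨-least (y≤x∨y y x) (x≤x∨y y x)

  ∨-comm : ∀ x y → x ∨ y ≡ y ∨ x
  ∨-comm x y = ≤-antisym (∨-comm≤ x y) (∨-comm≤ y x)

  ≤⇒ : ∀ s p → p ≤ s ⇒ p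
  ≤⇒ s p = proj₁ (⇒-compl s p)

  IsMeet-swap : IsMeet p q m → IsMeet q p m
  IsMeet-swap (m≤p , m≤q , greatest) = m≤q , m≤p , λ k k≤q k≤p → greatest k k≤p k≤q

  -- Modus ponens: s ∧ (s ⇒ p) ≤ p.  In [p,𝟏] the element w ∨ p lies below
  -- s ∨ p and its complement s ⇒ p, hence equals p.
  modus-ponens : w ≤ s → w ≤ s ⇒ p → w ≤ p
  modus-ponens {w = w} {s = s} {p = p} w≤s w≤s⇒p with ⇒-compl s p
  ... | p≤s⇒p , _ , (_ , _ , _ , greatest) =
    ≤-trans (x≤x∨y w p)
      (greatest (w ∨ p) (y≤x∨y w p)
        (∨-least (≤-trans w≤s (x≤x∨y s p)) (y≤x∨y s p))
        (∨-least w≤s⇒p p≤s⇒p))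

  -- Distributivity of [e,𝟏] as a proof principle: if w ≤ s ∨ t then
  -- w = (w ∧ s) ∨ (w ∧ t), so to bound w it suffices to bound the elements
  -- of [e,w] lying below s and those lying below t.
  bound-by-cover : e ≤ w → e ≤ s → e ≤ t → w ≤ s ∨ t →
                   (∀ k → e ≤ k → k ≤ w → k ≤ s → k ≤ R) →
                   (∀ k → e ≤ k → k ≤ w → k ≤ t → k ≤ R) → w ≤ R
  bound-by-cover {e = e} {w = w} {s = s} {t = t} {R = R} e≤w e≤s e≤t w≤s∨t bound-s bound-t
    with interval-meet e w (s ∨ t) e≤w (≤-trans e≤s (x≤x∨y s t))
       | interval-meet e w s e≤w e≤s
       | interval-meet e w t e≤w e≤t
  ... | w∧[s∨t] , meet-st@(_ , w∧[s∨t]≤w , _ , greatest-st)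
      | w∧s , meet-s@(e≤w∧s , w∧s≤w , w∧s≤s , _)
      | w∧t , meet-t@(e≤w∧t , w∧t≤w , w∧t≤t , _) =
    subst (_≤ R) (sym w≡[w∧s]∨[w∧t])
      (∨-least (bound-s w∧s e≤w∧s w∧s≤w w∧s≤s) (bound-t w∧t e≤w∧t w∧t≤w w∧t≤t))
    where
    w≡[w∧s]∨[w∧t] : w ≡ w∧s ∨ w∧t
    w≡[w∧s]∨[w∧t] =
      trans (≤-antisym (greatest-st w e≤w ≤-refl w≤s∨t) w∧[s∨t]≤w)
            (interval-distr e≤w e≤s e≤t meet-st meet-s meet-t)

  meet-of-joins : IsMeet p q m → m ≤ r → IsMeet (r ∨ p) (r ∨ q) r
  meet-of-joins {p = p} {q = q} {m = m} {r = r} (m≤p , m≤q , greatest) m≤r =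
    x≤x∨y r p , x≤x∨y r q , below-r
    where
    below-r : ∀ z → z ≤ r ∨ p → z ≤ r ∨ q → z ≤ r
    below-r z z≤r∨p z≤r∨q =
      ≤-trans (x≤x∨y z r)
        (bound-by-cover m≤z∨r m≤r m≤p (∨-least z≤r∨p (x≤x∨y r p))
          (λ _ _ _ k≤r → k≤r)
          (λ k m≤k k≤z∨r k≤p →
            bound-by-cover m≤k m≤r m≤q
              (≤-trans k≤z∨r (∨-least z≤r∨q (x≤x∨y r q)))
              (λ _ _ _ k'≤r → k'≤r)
              (λ k' _ k'≤k k'≤q →
                ≤-trans (greatest k' (≤-trans k'≤k k≤p) k'≤q) m≤r)))
      where
      m≤z∨r : m ≤ z ∨ r
      m≤z∨r = ≤-trans m≤r (y≤x∨y z r)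

  -- If c ∨ d = 𝟏 and c ∧ d ≤ b, then the complement of b ∨ d in [b,𝟏]
  -- is c ∨ b: split each side along a decomposition of 𝟏.
  ⇒-as-join : c ∨ d ≡ 𝟏 → IsMeet c d m → m ≤ b → (b ∨ d) ⇒ b ≡ c ∨ b
  ⇒-as-join {c = c} {d = d} {m = m} {b = b} c∨d≡𝟏 meet-cd@(m≤c , m≤d , _) m≤b
    with ⇒-compl (b ∨ d) b
  ... | b≤u , [b∨d]∨u≡𝟏 , _ = ≤-antisym u≤c∨b c∨b≤u
    where
    u = (b ∨ d) ⇒ b

    -- split u along c ∨ d = 𝟏; the part below d lies below b by modus ponens
    u≤c∨b : u ≤ c ∨ b
    u≤c∨b = bound-by-cover (≤-trans m≤b b≤u) m≤c m≤d
      (subst (u ≤_) (sym c∨d≡𝟏) (≤𝟏 u))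
      (λ k _ _ k≤c → ≤-trans k≤c (x≤x∨y c b))
      (λ k _ k≤u k≤d →
        ≤-trans (modus-ponens (≤-trans k≤d (y≤x∨y b d)) k≤u) (y≤x∨y c b))

    -- split c ∨ b along ((b ∨ d) ∨ b) ∨ u = 𝟏; the part below b ∨ d lies
    -- below (b ∨ c) ∧ (b ∨ d) = b
    c∨b≤u : c ∨ b ≤ u
    c∨b≤u = bound-by-cover (y≤x∨y c b) (y≤x∨y (b ∨ d) b) b≤u
      (subst (c ∨ b ≤_) (sym [b∨d]∨u≡𝟏) (≤𝟏 (c ∨ b)))
      (λ k _ k≤c∨b k≤[b∨d]∨b →
        ≤-trans (proj₂ (proj₂ (meet-of-joins meet-cd m≤b)) k
                  (≤-trans k≤c∨b (∨-comm≤ c b))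
                  (≤-trans k≤[b∨d]∨b (∨-least ≤-refl (x≤x∨y b d))))
                b≤u)
      (λ _ _ _ k≤u → k≤u)

  ∼-equal-meets : IsMeet (a ∨ c) ((b ∨ d) ⇒ b) c → IsMeet (b ∨ d) ((a ∨ c) ⇒ a) d →
                  IsMeet a b m → IsMeet c d n → m ≡ n
  ∼-equal-meets {a = a} {c = c} {b = b} {d = d} {m = m} {n = n}
    (_ , c≤[b∨d]⇒b , greatest-c) (_ , d≤[a∨c]⇒a , greatest-d)
    (m≤a , m≤b , greatest-ab) (n≤c , n≤d , greatest-cd) =
    ≤-antisym (greatest-cd m m≤c m≤d) (greatest-ab n n≤a n≤b)
    where
    m≤c : m ≤ c
    m≤c = greatest-c m (≤-trans m≤a (x≤x∨y a c)) (≤-trans m≤b (≤⇒ (b ∨ d) b))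
    m≤d : m ≤ d
    m≤d = greatest-d m (≤-trans m≤b (x≤x∨y b d)) (≤-trans m≤a (≤⇒ (a ∨ c) a))
    n≤a : n ≤ a
    n≤a = modus-ponens (≤-trans n≤c (y≤x∨y a c)) (≤-trans n≤d d≤[a∨c]⇒a)
    n≤b : n ≤ b
    n≤b = modus-ponens (≤-trans n≤d (y≤x∨y b d)) (≤-trans n≤c c≤[b∨d]⇒b)

  -- "⇐": when a ∧ b = c ∧ d and c ∨ d = 𝟏, the first equation of
  -- ⟨a,b⟩ ∼ ⟨c,d⟩ holds, since (a ∨ c) ∧ ((b ∨ d) ⇒ b) = (c ∨ a) ∧ (c ∨ b) = c.
  equal-meets-Δ : c ∨ d ≡ 𝟏 → IsMeet a b m → IsMeet c d m →
                  IsMeet (a ∨ c) ((b ∨ d) ⇒ b) c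
  equal-meets-Δ {c = c} {d = d} {a = a} {b = b} {m = m} c∨d≡𝟏 meet-ab meet-cd@(m≤c , _ , _) =
    subst₂ (λ x y → IsMeet x y c) (∨-comm c a) (sym (⇒-as-join c∨d≡𝟏 meet-cd m≤b))
      (meet-of-joins meet-ab m≤c)
    where
    m≤b : m ≤ b
    m≤b = proj₁ (proj₂ meet-ab)

lemma2p7 : ∀ {c ℓ} (𝓘 : ImplicationAlgebra c ℓ) (x y : IElem 𝓘) →
    (_∼_ 𝓘 x y → meet x ≡ meet y) × (meet x ≡ meet y → _∼_ 𝓘 x y)
lemma2p7 𝓘 ⟨ a , b ⟩[ _ , _ , meet-ab ] ⟨ c , d ⟩[ c∨d≡𝟏 , _ , meet-cd ] =
  (λ (first , second) → ∼-equal-meets first second meet-ab meet-cd) ,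
  λ m≡n → let meet-cd' = subst (IsMeet c d) (sym m≡n) meet-cd in
    equal-meets-Δ c∨d≡𝟏 meet-ab meet-cd' ,
    equal-meets-Δ (trans (∨-comm d c) c∨d≡𝟏) (IsMeet-swap meet-ab) (IsMeet-swap meet-cd')
  where
  open ImplicationAlgebra 𝓘
  open ImplicationAlgebraProperties 𝓘
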